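{- Let $\mathcal{X}$ be the set of perfect matchings of the complete graph $K_{2n}$. For any edge $ij$ of $K_{2n}$ and any $m' \in \mathcal{X}$ with $ij \notin m'$, $$|\{ m \in \mathcal{X} : ij \in m \text{ and } m \cap m' \neq \emptyset \}| \leq (1-1/\sqrt{e})(2n-3)!! < \frac{2}{5}(2n-3)!!.$$
   Context: Perfect matchings are viewed as sets of edges, so $m \cap m' \neq \emptyset$ means $m$ and $m'$ share an edge. $(2n-3)!! = 1\cdot 3 \cdots (2n-3)$ is the number of perfect matchings of $K_{2n}$ containing a fixed edge. -}

module Defs where

open import Data.Nat using (ℕ; zero; suc; _+_; _*_; _∸_; _≤_; _<_)
open import Data.Nat using (_!)
open import Data.Sum using (_⊎_)
open import Data.Fin using (Fin)
open import Data.Vec using (Vec; lookup)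
open import Data.Product using (_×_)
open import Relation.Binary.PropositionalEquality using (_≡_; _≢_)

-- A perfect matching of the complete graph K_k on vertex set Fin k, encoded
-- as its partner table v : v[x] is the vertex matched to x.
-- The edge {x , v[x]} belongs to the matching; edge ij ∈ m  iff  lookup m i ≡ j.
IsPerfectMatching : {k : ℕ} → Vec (Fin k) k → Set
IsPerfectMatching {k} v = ∀ (x : Fin k) → (lookup v (lookup v x) ≡ x) × (lookup v x ≢ x)

-- dfact n = (2n-3)!! = 1·3·…·(2n-3)  (dfact 0 = dfact 1 = 1).
dfact : ℕ → ℕ
dfact zero = 1
dfact (suc zero) = 1
dfact (suc (suc n)) = (2 * n + 1) * dfact (suc n)

-- T N = Σ_{k=0}^{N} N!/k!  (so T N / N! is the N-th partial sum of the series for e)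
-- computed by T 0 = 1, T (N+1) = (N+1)·T N + 1.
T : ℕ → ℕ
T zero = 1
T (suc n) = suc n * T n + 1

-- Real inequality  c ≤ (1 - 1/√e)·D  for natural numbers c, D, expressed with
-- natural numbers only.  For D > 0 it is equivalent to
--   c < D  and  D² / (D-c)² ≤ e,
-- and  r ≤ e  holds iff  r ≤ U_N := Σ_{k≤N} 1/k! + 1/(N!·N)  for every N ≥ 1
-- (U_N is a strictly decreasing sequence of upper bounds converging to e).
-- Clearing denominators (N!·N) gives the condition below, with N = suc k.
-- (For D = 0 the real inequality reads c ≤ 0, i.e. c ≡ 0; the k-clause is then trivial.)
LeOneMinusInvSqrtE : ℕ → ℕ → Set
LeOneMinusInvSqrtE c D =
  ((c < D) ⊎ (c ≡ 0 × D ≡ 0)) ×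
  (∀ (k : ℕ) → D * D * (suc k ! * suc k) ≤ (D ∸ c) * (D ∸ c) * (suc k * T (suc k) + 1))

-- The matchings containing ij are the perfect matchings of the other
-- 2n − 2 vertices, where m′ pairs up all vertices except a = m′ i and b = m′ j; so we count
-- matchings of p = n − 2 designated pairs and 2 free points that contain a designated pair.
-- Their number hitting p 2 is (2n − 3)!! minus the number avoiding p 2 of those avoiding all
-- pairs.  Declaring two free points of q + 2 points a designated pair shrinks the avoiding
-- count by a factor at most q / (q + 1), hence avoiding p 2 ≥ (2p / (2p + 1)) ^ p · (2n − 3)!!,
-- and (1 + 1/b) ^ b ≤ Σ_{k ≤ b} 1/k! ≤ e turns this into avoiding p 2 ≥ (2n − 3)!! / √e.

module Submission where

open import Defs
open import Data.Nat using (ℕ; _*_; _<_)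
open import Data.Fin using (Fin)
open import Data.Vec using (Vec; lookup)
open import Data.List using (List; length)
open import Data.List.Relation.Unary.All using (All)
open import Data.List.Relation.Unary.Unique.Propositional using (Unique)
open import Data.Product using (_×_; ∃)
open import Relation.Binary.PropositionalEquality using (_≡_; _≢_)

open import Data.Nat.Base
  using (zero; suc; _+_; _^_; _≤_; _∸_; _!; pred; z≤n; s≤s; z<s; >-nonZero; +-*-rawSemiring)
open import Data.Nat.Properties
open import Data.Nat.Combinatorics using (_C_; nCk+nC[k+1]≡[n+1]C[k+1])
open import Data.Nat.ListAction using (sum)
open import Data.Nat.ListAction.Properties using (sum-++)
open import Data.Nat.Tactic.RingSolver using (solve-∀)
open import Algebra.Definitions.RawSemiring +-*-rawSemiring using () renaming (_^_ to _^′_; _×_ to _×′_)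
open import Algebra.Properties.CommutativeSemiring.Binomial +-*-commutativeSemiring using (theorem)
open import Algebra.Properties.Semiring.Sum +-*-semiring
  using (sum⁺-syntax; sum-cong-≗; *-distribˡ-sum; *-distribʳ-sum) renaming (sum to sumᵥ)
import Data.Fin.Base as Fin
open import Data.Fin.Base using (toℕ)
open import Data.Fin.Properties using (toℕ≤pred[n]; ¬∀⟶∃¬) renaming (_≟_ to _≟ᶠ_)
open import Data.Vec.Functional using (Vector)
open import Data.Vec.Properties using (tabulate∘lookup; tabulate-cong)
open import Data.List.Base using ([]; _∷_; _++_; map; filter; allFin)
open import Data.List.Properties using (map-++; length-++; filter-all; length-map; length-tabulate)
open import Data.List.Relation.Unary.All as All using ([]; _∷_)
open import Data.List.Relation.Unary.All.Properties
  using (all-filter; All¬⇒¬Any) renaming (filter⁺ to All-filter⁺; map⁺ to All-map⁺)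
open import Data.List.Relation.Unary.Any using (Any; here; there)
open import Data.List.Relation.Unary.AllPairs as AllPairs using (AllPairs; []; _∷_)
open import Data.List.Relation.Unary.AllPairs.Properties
  using () renaming (filter⁺ to AllPairs-filter⁺; map⁺ to AllPairs-map⁺)
open import Data.List.Relation.Unary.Unique.Propositional.Properties using (allFin⁺)
open import Data.List.Membership.Propositional using (_∈_; _∉_)
open import Data.List.Membership.Propositional.Properties using (∈-∃++; ∈-++⁺ˡ; ∈-++⁺ʳ; ∈-allFin)
open import Data.List.Relation.Binary.Permutation.Propositional
  using (_↭_; prep; swap; ↭-refl; ↭-sym; ↭-trans; ↭⇒↭ₛ; module PermutationReasoning)
open import Data.List.Relation.Binary.Permutation.Propositional.Properties
  using (∈-resp-↭; shift; shifts; ++⁺ˡ; ++⁺ʳ; ↭-length) renaming (++-comm to ↭-++-comm)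
open import Data.Product.Base using (_,_; proj₁; proj₂; ∃-syntax; map₂)
open import Data.Sum.Base using (_⊎_; inj₁; inj₂)
open import Function.Base using (_∘_; _$_)
open import Relation.Binary.Definitions using (DecidableEquality)
open import Relation.Binary.PropositionalEquality
  using (refl; sym; trans; cong; cong₂; subst; setoid; module ≡-Reasoning)
open import Relation.Nullary using (¬_; yes; no; contradiction)

-- Counting matchings that hit or avoid designated pairs

-- Given r disjoint designated
-- pairs and s further free points, hitting r s and avoiding r s count the perfect matchings
-- of these 2r + s points that contain some, respectively none, of the designated pairs;
-- the recursions match the first point of the first pair.
matchings : ℕ → ℕ
matchings zero = 1
matchings (suc zero) = 0
matchings (suc (suc ℓ)) = suc ℓ * matchings ℓ

hitting : ℕ → ℕ → ℕ
hitting zero s = 0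
hitting (suc zero) s = matchings s
hitting (suc (suc r)) s =
  matchings (suc r + suc r + s) + s * hitting (suc r) s + (suc r + suc r) * hitting r (2 + s)

avoiding : ℕ → ℕ → ℕ
avoiding zero s = matchings s
avoiding (suc zero) s = s * matchings s
avoiding (suc (suc r)) s = s * avoiding (suc r) s + (suc r + suc r) * avoiding r (2 + s)

matchings-suc : ∀ ℓ → matchings (suc ℓ) ≡ ℓ * matchings (pred ℓ)
matchings-suc zero = refl
matchings-suc (suc ℓ) = refl

hitting-suc : ∀ r s →
  hitting (suc r) s ≡ matchings (r + r + s) + ((r + r) * hitting (pred r) (2 + s) + s * hitting r s)
hitting-suc zero s = sym (trans (cong (matchings s +_) (*-zeroʳ s)) (+-identityʳ (matchings s)))
hitting-suc (suc r) s =
  regroup (matchings (suc r + suc r + s)) (s * hitting (suc r) s) ((suc r + suc r) * hitting r (2 + s))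
  where
  regroup : ∀ m a b → m + a + b ≡ m + (b + a)
  regroup = solve-∀

[1+r]+[1+r]+s≡r+r+[2+s] : ∀ r s → suc r + suc r + s ≡ r + r + (2 + s)
[1+r]+[1+r]+s≡r+r+[2+s] = solve-∀

hitting+avoiding≡matchings : ∀ r s → hitting r s + avoiding r s ≡ matchings (r + r + s)
hitting+avoiding≡matchings zero s = refl
hitting+avoiding≡matchings (suc zero) s = refl
hitting+avoiding≡matchings (suc (suc r)) s = begin
  (M + s * hitting (suc r) s + c * hitting r (2 + s)) + (s * avoiding (suc r) s + c * avoiding r (2 + s))
    ≡⟨ regroup M (hitting (suc r) s) (avoiding (suc r) s) (hitting r (2 + s)) (avoiding r (2 + s)) s c ⟩
  M + s * (hitting (suc r) s + avoiding (suc r) s) + c * (hitting r (2 + s) + avoiding r (2 + s))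
    ≡⟨ cong₂ (λ u v → M + s * u + c * v) (hitting+avoiding≡matchings (suc r) s)
                                         (hitting+avoiding≡matchings r (2 + s)) ⟩
  M + s * M + c * matchings (r + r + (2 + s))
    ≡⟨ cong (λ q → M + s * M + c * matchings q) ([1+r]+[1+r]+s≡r+r+[2+s] r s) ⟨
  M + s * M + c * M
    ≡⟨ collect M r s ⟩
  matchings (2 + (suc r + suc r + s))
    ≡⟨ cong matchings (size r s) ⟨
  matchings (suc (suc r) + suc (suc r) + s) ∎
  where
  open ≡-Reasoning
  M = matchings (suc r + suc r + s)
  c = suc r + suc r
  regroup : ∀ m h₁ a₁ h₀ a₀ s c →
            (m + s * h₁ + c * h₀) + (s * a₁ + c * a₀) ≡ m + s * (h₁ + a₁) + c * (h₀ + a₀)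
  regroup = solve-∀
  collect : ∀ m r s → m + s * m + (suc r + suc r) * m ≡ suc (suc r + suc r + s) * m
  collect = solve-∀
  size : ∀ r s → suc (suc r) + suc (suc r) + s ≡ 2 + (suc r + suc r + s)
  size = solve-∀

avoiding-unpair : ∀ r s → avoiding r (2 + s) ≡ avoiding (suc r) s + avoiding r s
avoiding-unpair zero s = +-comm (matchings s) (s * matchings s)
avoiding-unpair (suc zero) s = expand s (matchings s)
  where
  expand : ∀ s m → (2 + s) * ((1 + s) * m) ≡ (s * (s * m) + 2 * ((1 + s) * m)) + s * m
  expand = solve-∀
avoiding-unpair (suc (suc r)) s = begin
  (2 + s) * W + c * avoiding r (4 + s)  ≡⟨ cong (λ v → (2 + s) * W + c * v) (avoiding-unpair r (2 + s)) ⟩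
  (2 + s) * W + c * (W + Z)             ≡⟨ regroup r s W Z ⟩
  s * W + c′ * W + c * Z                ≡⟨ cong (λ w → s * w + c′ * W + c * Z) (avoiding-unpair (suc r) s) ⟩
  s * (X + Y) + c′ * W + c * Z          ≡⟨ regroup′ s c c′ X Y W Z ⟩
  (s * X + c′ * W) + (s * Y + c * Z)    ∎
  where
  open ≡-Reasoning
  c = suc r + suc r
  c′ = suc (suc r) + suc (suc r)
  W = avoiding (suc r) (2 + s)
  X = avoiding (suc (suc r)) s
  Y = avoiding (suc r) s
  Z = avoiding r (2 + s)
  regroup : ∀ r s w z → (2 + s) * w + (suc r + suc r) * (w + z)
                      ≡ s * w + (suc (suc r) + suc (suc r)) * w + (suc r + suc r) * z
  regroup = solve-∀
  regroup′ : ∀ s c c′ x y w z → s * (x + y) + c′ * w + c * z ≡ (s * x + c′ * w) + (s * y + c * z)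
  regroup′ = solve-∀

avoiding-expandFree : ∀ r s →
  avoiding (suc r) (2 + s) ≡ (1 + s) * avoiding (suc r) s + (suc r + suc r) * avoiding r (2 + s)
avoiding-expandFree zero s = expand s (matchings s)
  where
  expand : ∀ s m → (2 + s) * ((1 + s) * m) ≡ (1 + s) * (s * m) + 2 * ((1 + s) * m)
  expand = solve-∀
avoiding-expandFree (suc r) s = begin
  (2 + s) * W + c * avoiding r (4 + s)
    ≡⟨ cong₂ (λ w v → (2 + s) * w + c * v) W≡X+Y (trans (avoiding-unpair r (2 + s)) (cong (_+ Z) W≡X+Y)) ⟩
  (2 + s) * (X + Y) + c * ((X + Y) + Z)
    ≡⟨ expand s r Y Z ⟩
  (1 + s) * X + c′ * (X + Y)
    ≡⟨ cong (λ w → (1 + s) * X + c′ * w) W≡X+Y ⟨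
  (1 + s) * X + c′ * W ∎
  where
  open ≡-Reasoning
  c = suc r + suc r
  c′ = suc (suc r) + suc (suc r)
  W = avoiding (suc r) (2 + s)
  X = avoiding (suc (suc r)) s
  Y = avoiding (suc r) s
  Z = avoiding r (2 + s)
  W≡X+Y : W ≡ X + Y
  W≡X+Y = avoiding-unpair (suc r) s
  expand : ∀ s r y z → let c = suc r + suc r in
           (2 + s) * ((s * y + c * z) + y) + c * (((s * y + c * z) + y) + z)
           ≡ (1 + s) * (s * y + c * z) + (suc (suc r) + suc (suc r)) * ((s * y + c * z) + y)
  expand = solve-∀

avoiding-growth : ∀ r s → suc (r + r + s) * avoiding r s ≤ avoiding r (2 + s)
avoiding-growth zero s = ≤-refl
avoiding-growth (suc r) s = begin
  suc (suc r + suc r + s) * Y          ≡⟨ split r s Y ⟩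
  (1 + s) * Y + (suc r + suc r) * Y    ≤⟨ +-monoʳ-≤ ((1 + s) * Y) (*-monoʳ-≤ (suc r + suc r) Y≤Z) ⟩
  (1 + s) * Y + (suc r + suc r) * Z    ≡⟨ avoiding-expandFree r s ⟨
  avoiding (suc r) (2 + s)             ∎
  where
  open ≤-Reasoning
  Y = avoiding (suc r) s
  Z = avoiding r (2 + s)
  Y≤Z : Y ≤ Z
  Y≤Z = ≤-trans (m≤m+n Y (avoiding r s)) (≤-reflexive (sym (avoiding-unpair r s)))
  split : ∀ r s y → suc (suc r + suc r + s) * y ≡ (1 + s) * y + (suc r + suc r) * y
  split = solve-∀

avoiding-pairUp : ∀ r s → (r + r + s) * avoiding r (2 + s) ≤ suc (r + r + s) * avoiding (suc r) s
avoiding-pairUp r s = +-cancelʳ-≤ W (q * W) (suc q * Y) (begin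
  q * W + W                          ≡⟨ +-comm (q * W) W ⟩
  suc q * W                          ≡⟨ cong (suc q *_) (avoiding-unpair r s) ⟩
  suc q * (Y + avoiding r s)         ≡⟨ *-distribˡ-+ (suc q) Y (avoiding r s) ⟩
  suc q * Y + suc q * avoiding r s   ≤⟨ +-monoʳ-≤ (suc q * Y) (avoiding-growth r s) ⟩
  suc q * Y + W                      ∎)
  where
  open ≤-Reasoning
  q = r + r + s
  W = avoiding r (2 + s)
  Y = avoiding (suc r) s

avoiding-lowerBound : ∀ r s → let q = r + r + s in
  q ^ r * matchings (2 + q) ≤ suc q ^ r * avoiding r (2 + s)
avoiding-lowerBound zero s = ≤-refl
avoiding-lowerBound (suc r) s = begin
  q ^ suc r * matchings (2 + q)                   ≡⟨ *-assoc q (q ^ r) _ ⟩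
  q * (q ^ r * matchings (2 + q))                 ≤⟨ *-monoʳ-≤ q previous ⟩
  q * (suc q ^ r * avoiding r (4 + s))            ≡⟨ x*[y*z]≡y*[x*z] q (suc q ^ r) _ ⟩
  suc q ^ r * (q * avoiding r (4 + s))            ≤⟨ *-monoʳ-≤ (suc q ^ r) step ⟩
  suc q ^ r * (suc q * avoiding (suc r) (2 + s))  ≡⟨ x*[y*z]≡y*[x*z] (suc q ^ r) (suc q) _ ⟩
  suc q * (suc q ^ r * avoiding (suc r) (2 + s))  ≡⟨ *-assoc (suc q) (suc q ^ r) _ ⟨
  suc q ^ suc r * avoiding (suc r) (2 + s)        ∎
  where
  open ≤-Reasoning
  q = suc r + suc r + s
  q≡ : r + r + (2 + s) ≡ q
  q≡ = sym ([1+r]+[1+r]+s≡r+r+[2+s] r s)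
  previous : q ^ r * matchings (2 + q) ≤ suc q ^ r * avoiding r (4 + s)
  previous = subst (λ p → p ^ r * matchings (2 + p) ≤ suc p ^ r * avoiding r (4 + s)) q≡
                   (avoiding-lowerBound r (2 + s))
  step : q * avoiding r (4 + s) ≤ suc q * avoiding (suc r) (2 + s)
  step = subst (λ p → p * avoiding r (4 + s) ≤ suc p * avoiding (suc r) (2 + s)) q≡ (avoiding-pairUp r (2 + s))
  x*[y*z]≡y*[x*z] : ∀ x y z → x * (y * z) ≡ y * (x * z)
  x*[y*z]≡y*[x*z] = solve-∀

-- The binomial bound and the partial sums of e

×′≡* : ∀ m n → m ×′ n ≡ m * n
×′≡* zero n = refl
×′≡* (suc m) n = cong (n +_) (×′≡* m n)

^′≡^ : ∀ m n → m ^′ n ≡ m ^ n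
^′≡^ m zero = refl
^′≡^ m (suc n) = cong (m *_) (^′≡^ m n)

sum-mono-≤ : ∀ {n} {f g : Vector ℕ n} → (∀ i → f i ≤ g i) → sumᵥ f ≤ sumᵥ g
sum-mono-≤ {zero} f≤g = z≤n
sum-mono-≤ {suc n} f≤g = +-mono-≤ (f≤g Fin.zero) (sum-mono-≤ (f≤g ∘ Fin.suc))

[1+b]^b≡∑binomial : ∀ b → suc b ^ b ≡ ∑[ k ≤ b ] ((b C toℕ k) * b ^ toℕ k)
[1+b]^b≡∑binomial b = begin
  suc b ^ b                             ≡⟨ cong (_^ b) (+-comm 1 b) ⟩
  (b + 1) ^ b                           ≡⟨ ^′≡^ (b + 1) b ⟨
  (b + 1) ^′ b                          ≡⟨ theorem b b 1 ⟩
  _                                     ≡⟨ sum-cong-≗ {suc b} term ⟩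
  ∑[ k ≤ b ] ((b C toℕ k) * b ^ toℕ k)  ∎
  where
  open ≡-Reasoning
  term : ∀ k → (b C toℕ k) ×′ (b ^′ toℕ k * 1 ^′ (b ∸ toℕ k)) ≡ (b C toℕ k) * b ^ toℕ k
  term k = begin
    (b C toℕ k) ×′ (b ^′ toℕ k * 1 ^′ (b ∸ toℕ k))  ≡⟨ ×′≡* (b C toℕ k) _ ⟩
    (b C toℕ k) * (b ^′ toℕ k * 1 ^′ (b ∸ toℕ k))
      ≡⟨ cong₂ (λ u v → (b C toℕ k) * (u * v)) (^′≡^ b (toℕ k))
               (trans (^′≡^ 1 (b ∸ toℕ k)) (^-zeroˡ (b ∸ toℕ k))) ⟩
    (b C toℕ k) * (b ^ toℕ k * 1)                    ≡⟨ cong ((b C toℕ k) *_) (*-identityʳ (b ^ toℕ k)) ⟩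
    (b C toℕ k) * b ^ toℕ k                          ∎

falling : ℕ → ℕ → ℕ
falling n zero = 1
falling zero (suc k) = 0
falling (suc n) (suc k) = suc n * falling n k

falling-suc : ∀ n k → falling n (suc k) + k * falling n k ≡ n * falling n k
falling-suc zero zero = refl
falling-suc zero (suc k) = *-zeroʳ (suc k)
falling-suc (suc n) zero = +-identityʳ _
falling-suc (suc n) (suc k) = begin
  suc n * falling n (suc k) + suc k * (suc n * falling n k)
    ≡⟨ regroup (suc n) (falling n (suc k)) (falling n k) k ⟩
  suc n * (falling n (suc k) + k * falling n k) + suc n * falling n k
    ≡⟨ cong (λ z → suc n * z + suc n * falling n k) (falling-suc n k) ⟩
  suc n * (n * falling n k) + suc n * falling n k
    ≡⟨ collect n (falling n k) ⟩
  suc n * (suc n * falling n k) ∎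
  where
  open ≡-Reasoning
  regroup : ∀ a x y k → a * x + suc k * (a * y) ≡ a * (x + k * y) + a * y
  regroup = solve-∀
  collect : ∀ n y → suc n * (n * y) + suc n * y ≡ suc n * (suc n * y)
  collect = solve-∀

C*!≡falling : ∀ n k → (n C k) * k ! ≡ falling n k
C*!≡falling n zero = refl
C*!≡falling zero (suc k) = refl
C*!≡falling (suc n) (suc k) = begin
  (suc n C suc k) * (suc k * k !)
    ≡⟨ cong (_* (suc k * k !)) (nCk+nC[k+1]≡[n+1]C[k+1] n k) ⟨
  ((n C k) + (n C suc k)) * (suc k * k !)
    ≡⟨ regroup (n C k) (n C suc k) k (k !) ⟩
  suc k * ((n C k) * k !) + (n C suc k) * suc k !
    ≡⟨ cong₂ (λ u v → suc k * u + v) (C*!≡falling n k) (C*!≡falling n (suc k)) ⟩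
  suc k * falling n k + falling n (suc k)
    ≡⟨ regroup′ k (falling n k) (falling n (suc k)) ⟩
  falling n k + (falling n (suc k) + k * falling n k)
    ≡⟨ cong (falling n k +_) (falling-suc n k) ⟩
  falling n k + n * falling n k ∎
  where
  open ≡-Reasoning
  regroup : ∀ a c k f → (a + c) * (suc k * f) ≡ suc k * (a * f) + c * (suc k * f)
  regroup = solve-∀
  regroup′ : ∀ k x y → suc k * x + y ≡ x + (y + k * x)
  regroup′ = solve-∀

T≡∑falling : ∀ b → T b ≡ ∑[ k ≤ b ] falling b (toℕ k)
T≡∑falling zero = refl
T≡∑falling (suc b) = begin
  suc b * T b + 1                            ≡⟨ +-comm (suc b * T b) 1 ⟩
  1 + suc b * T b                            ≡⟨ cong (λ x → 1 + suc b * x) (T≡∑falling b) ⟩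
  1 + suc b * ∑[ k ≤ b ] falling b (toℕ k)
    ≡⟨ cong (1 +_) (*-distribˡ-sum {suc b} (suc b) (λ k → falling b (toℕ k))) ⟩
  1 + ∑[ k ≤ b ] (suc b * falling b (toℕ k)) ∎
  where open ≡-Reasoning

[k+m]!≤[k+m]^m*k! : ∀ k m → (k + m) ! ≤ (k + m) ^ m * k !
[k+m]!≤[k+m]^m*k! k zero = ≤-reflexive (trans (cong _! (+-identityʳ k)) (sym (*-identityˡ (k !))))
[k+m]!≤[k+m]^m*k! k (suc m) rewrite +-suc k m = begin
  suc (k + m) * (k + m) !                ≤⟨ *-monoʳ-≤ (suc (k + m)) ([k+m]!≤[k+m]^m*k! k m) ⟩
  suc (k + m) * ((k + m) ^ m * k !)      ≤⟨ *-monoʳ-≤ (suc (k + m)) (*-monoˡ-≤ (k !) (^-monoˡ-≤ m (n≤1+n (k + m)))) ⟩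
  suc (k + m) * (suc (k + m) ^ m * k !)  ≡⟨ *-assoc (suc (k + m)) (suc (k + m) ^ m) (k !) ⟨
  suc (k + m) ^ suc m * k !              ∎
  where open ≤-Reasoning

binomialTerm-bound : ∀ b k → k ≤ b → (b C k) * b ^ k * b ! ≤ b ^ b * falling b k
binomialTerm-bound b k k≤b with m , refl ← m≤n⇒∃[o]m+o≡n k≤b = begin
  ((k + m) C k) * (k + m) ^ k * (k + m) !
    ≤⟨ *-monoʳ-≤ (((k + m) C k) * (k + m) ^ k) ([k+m]!≤[k+m]^m*k! k m) ⟩
  ((k + m) C k) * (k + m) ^ k * ((k + m) ^ m * k !)
    ≡⟨ regroup ((k + m) C k) ((k + m) ^ k) ((k + m) ^ m) (k !) ⟩
  ((k + m) ^ k * (k + m) ^ m) * (((k + m) C k) * k !)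
    ≡⟨ cong₂ _*_ (sym (^-distribˡ-+-* (k + m) k m)) (C*!≡falling (k + m) k) ⟩
  (k + m) ^ (k + m) * falling (k + m) k ∎
  where
  open ≤-Reasoning
  regroup : ∀ c x y f → c * x * (y * f) ≡ (x * y) * (c * f)
  regroup = solve-∀

infix 4 _÷_≼_÷_

record _÷_≼_÷_ (a b c d : ℕ) : Set where
  constructor *≤*
  field cross : a * d ≤ c * b

open _÷_≼_÷_ using (cross)

≼-trans : ∀ {a b c d e f} → 0 < d → a ÷ b ≼ c ÷ d → c ÷ d ≼ e ÷ f → a ÷ b ≼ e ÷ f
≼-trans {a} {b} {c} {d} {e} {f} 0<d (*≤* ad≤cb) (*≤* cf≤ed) =
  *≤* $ *-cancelʳ-≤ (a * f) (e * b) d {{>-nonZero 0<d}} (begin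
    a * f * d  ≡⟨ x*y*z≡x*z*y a f d ⟩
    a * d * f  ≤⟨ *-monoˡ-≤ f ad≤cb ⟩
    c * b * f  ≡⟨ x*y*z≡x*z*y c b f ⟩
    c * f * b  ≤⟨ *-monoˡ-≤ b cf≤ed ⟩
    e * d * b  ≡⟨ x*y*z≡x*z*y e d b ⟩
    e * b * d  ∎)
  where
  open ≤-Reasoning
  x*y*z≡x*z*y : ∀ x y z → x * y * z ≡ x * z * y
  x*y*z≡x*z*y = solve-∀

binomial≼partialSum : ∀ b → suc b ^ b ÷ b ^ b ≼ T b ÷ b !
binomial≼partialSum b = *≤* $ begin
  suc b ^ b * b !
    ≡⟨ cong (_* b !) ([1+b]^b≡∑binomial b) ⟩
  (∑[ k ≤ b ] ((b C toℕ k) * b ^ toℕ k)) * b !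
    ≡⟨ *-distribʳ-sum {suc b} (b !) (λ k → (b C toℕ k) * b ^ toℕ k) ⟩
  ∑[ k ≤ b ] ((b C toℕ k) * b ^ toℕ k * b !)
    ≤⟨ sum-mono-≤ (λ k → binomialTerm-bound b (toℕ k) (toℕ≤pred[n] k)) ⟩
  ∑[ k ≤ b ] (b ^ b * falling b (toℕ k))
    ≡⟨ *-distribˡ-sum {suc b} (b ^ b) (λ k → falling b (toℕ k)) ⟨
  b ^ b * ∑[ k ≤ b ] falling b (toℕ k)
    ≡⟨ cong (b ^ b *_) (T≡∑falling b) ⟨
  b ^ b * T b
    ≡⟨ *-comm (b ^ b) (T b) ⟩
  T b * b ^ b ∎
  where open ≤-Reasoning

-- T n ÷ n ! is the n-th partial sum of the series for e, and upperNum n ÷ upperDen n is the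
-- upper bound U_n of Defs.
upperNum upperDen : ℕ → ℕ
upperNum n = n * T n + 1
upperDen n = n ! * n

upperDen>0 : ∀ k → 0 < upperDen (suc k)
upperDen>0 k = *-mono-≤ (1≤n! (suc k)) (s≤s z≤n)

partialSum-mono : ∀ m d → T m ÷ m ! ≼ T (d + m) ÷ (d + m) !
partialSum-mono m zero = *≤* ≤-refl
partialSum-mono m (suc d) = ≼-trans (1≤n! (d + m)) (partialSum-mono m d) (step (d + m))
  where
  step : ∀ n → T n ÷ n ! ≼ T (suc n) ÷ suc n !
  step n = *≤* $ ≤-trans (m≤m+n (T n * suc n !) (n !)) (≤-reflexive (expand n (T n) (n !)))
    where
    expand : ∀ n t f → t * (suc n * f) + f ≡ (suc n * t + 1) * f
    expand = solve-∀

upperBound-antitone : ∀ k d →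
  upperNum (suc (d + k)) ÷ upperDen (suc (d + k)) ≼ upperNum (suc k) ÷ upperDen (suc k)
upperBound-antitone k zero = *≤* ≤-refl
upperBound-antitone k (suc d) = ≼-trans (upperDen>0 (d + k)) (step (d + k)) (upperBound-antitone k d)
  where
  step : ∀ n → upperNum (2 + n) ÷ upperDen (2 + n) ≼ upperNum (suc n) ÷ upperDen (suc n)
  step n = *≤* $ ≤-trans (m≤m+n _ (suc n !)) (≤-reflexive (expand (suc n) (T (suc n)) (suc n !)))
    where
    expand : ∀ n t f → (suc n * (suc n * t + 1) + 1) * (f * n) + f ≡ (n * t + 1) * ((suc n * f) * suc n)
    expand = solve-∀

partialSum≼upperBound : ∀ n → T (suc n) ÷ suc n ! ≼ upperNum (suc n) ÷ upperDen (suc n)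
partialSum≼upperBound n = *≤* $ ≤-trans (m≤m+n _ (suc n !)) (≤-reflexive (expand (suc n) (T (suc n)) (suc n !)))
  where
  expand : ∀ n t f → t * (f * n) + f ≡ (n * t + 1) * f
  expand = solve-∀

partialSum≼anyUpperBound : ∀ m k → T m ÷ m ! ≼ upperNum (suc k) ÷ upperDen (suc k)
partialSum≼anyUpperBound m k =
  ≼-trans (1≤n! (suc (k + m))) (partialSum-mono m (suc k))
    (≼-trans (upperDen>0 (k + m)) (partialSum≼upperBound (k + m))
      (subst (λ n → upperNum (suc n) ÷ upperDen (suc n) ≼ upperNum (suc k) ÷ upperDen (suc k))
             (+-comm m k) (upperBound-antitone k m)))

binomial≼anyUpperBound : ∀ b k → suc b ^ b ÷ b ^ b ≼ upperNum (suc k) ÷ upperDen (suc k)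
binomial≼anyUpperBound b k = ≼-trans (1≤n! b) (binomial≼partialSum b) (partialSum≼anyUpperBound b k)

-- Comparison with 1 − 1/√e

n^n>0 : ∀ n → 0 < n ^ n
n^n>0 zero = z<s
n^n>0 (suc n) = m^n>0 (suc n) (suc n)

positive-right-factor : ∀ m {n} → 0 < m * n → 0 < n
positive-right-factor m {zero} 0<m*0 = subst (0 <_) (*-zeroʳ m) 0<m*0
positive-right-factor m {suc n} _ = z<s

-- If A ≤ D ∸ c and (A / D)² ≥ (b / (1 + b)) ^ b, then (D / (D ∸ c))² ≤ (1 + 1/b) ^ b ≤ U_N for every N.
LeOneMinusInvSqrtE-fromRatio : ∀ b {c A D} → c + A ≤ D → 0 < D →
  b ^ b * (D * D) ≤ suc b ^ b * (A * A) → LeOneMinusInvSqrtE c D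
LeOneMinusInvSqrtE-fromRatio b {c} {A} {D} c+A≤D 0<D ratio = inj₁ c<D , bound
  where
  0<A : 0 < A
  0<A = positive-right-factor A
          (positive-right-factor (suc b ^ b) (≤-trans (*-mono-< (n^n>0 b) (*-mono-< 0<D 0<D)) ratio))
  c<D : c < D
  c<D = ≤-trans (≤-reflexive (+-comm 1 c)) (≤-trans (+-monoʳ-≤ c 0<A) c+A≤D)
  A≤D∸c : A ≤ D ∸ c
  A≤D∸c = m+n≤o⇒m≤o∸n A (≤-trans (≤-reflexive (+-comm A c)) c+A≤D)
  bound : ∀ k → D * D * upperDen (suc k) ≤ (D ∸ c) * (D ∸ c) * upperNum (suc k)
  bound k = ≤-trans (*-cancelˡ-≤ (b ^ b) {{>-nonZero (n^n>0 b)}} chain)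
                    (*-monoˡ-≤ (upperNum (suc k)) (*-mono-≤ A≤D∸c A≤D∸c))
    where
    open ≤-Reasoning
    num = upperNum (suc k)
    den = upperDen (suc k)
    regroup : ∀ x y z → x * y * z ≡ y * (x * z)
    regroup = solve-∀
    rotate : ∀ x y z → x * (y * z) ≡ z * (x * y)
    rotate = solve-∀
    chain : b ^ b * (D * D * den) ≤ b ^ b * (A * A * num)
    chain = begin
      b ^ b * (D * D * den)      ≡⟨ *-assoc (b ^ b) (D * D) den ⟨
      b ^ b * (D * D) * den      ≤⟨ *-monoˡ-≤ den ratio ⟩
      suc b ^ b * (A * A) * den  ≡⟨ regroup (suc b ^ b) (A * A) den ⟩
      A * A * (suc b ^ b * den)  ≤⟨ *-monoʳ-≤ (A * A) (cross (binomial≼anyUpperBound b k)) ⟩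
      A * A * (num * b ^ b)      ≡⟨ rotate (A * A) num (b ^ b) ⟩
      b ^ b * (A * A * num)      ∎

LeOneMinusInvSqrtE⇒5c<2D : ∀ {c D} → LeOneMinusInvSqrtE c D → 0 < D → 5 * c < 2 * D
LeOneMinusInvSqrtE⇒5c<2D (inj₂ (_ , refl) , _) ()
LeOneMinusInvSqrtE⇒5c<2D {c} {D} (inj₁ c<D , bound) 0<D = ≰⇒> λ 2D≤5c →
  <⇒≱ (*-monoˡ-< (D * D) {{>-nonZero (*-mono-< 0<D 0<D)}} (m<m+n 441 {9} z<s)) (450D²≤441D² (5E≤3D 2D≤5c))
  where
  open ≤-Reasoning
  E = D ∸ c
  5E≤3D : 2 * D ≤ 5 * c → 5 * E ≤ 3 * D
  5E≤3D 2D≤5c = +-cancelʳ-≤ (2 * D) (5 * E) (3 * D) (begin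
    5 * E + 2 * D  ≤⟨ +-monoʳ-≤ (5 * E) 2D≤5c ⟩
    5 * E + 5 * c  ≡⟨ *-distribˡ-+ 5 E c ⟨
    5 * (E + c)    ≡⟨ cong (5 *_) (m∸n+n≡m (<⇒≤ c<D)) ⟩
    5 * D          ≡⟨ split D ⟩
    3 * D + 2 * D  ∎)
    where
    split : ∀ d → 5 * d ≡ 3 * d + 2 * d
    split = solve-∀
  450D²≤441D² : 5 * E ≤ 3 * D → 450 * (D * D) ≤ 441 * (D * D)
  450D²≤441D² 5E≤3D = begin
    450 * (D * D)             ≡⟨ scale₁ D ⟩
    25 * (D * D * 18)         ≤⟨ *-monoʳ-≤ 25 (bound 2) ⟩
    25 * (E * E * 49)         ≡⟨ scale₂ E ⟩
    49 * ((5 * E) * (5 * E))  ≤⟨ *-monoʳ-≤ 49 (*-mono-≤ 5E≤3D 5E≤3D) ⟩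
    49 * ((3 * D) * (3 * D))  ≡⟨ scale₃ D ⟩
    441 * (D * D)             ∎
    where
    scale₁ : ∀ d → 450 * (d * d) ≡ 25 * (d * d * 18)
    scale₁ = solve-∀
    scale₂ : ∀ e → 25 * (e * e * 49) ≡ 49 * ((5 * e) * (5 * e))
    scale₂ = solve-∀
    scale₃ : ∀ d → 49 * ((3 * d) * (3 * d)) ≡ 441 * (d * d)
    scale₃ = solve-∀

module _ {A : Set} where

  sum-map-++ : ∀ (g : A → ℕ) xs ys → sum (map g (xs ++ ys)) ≡ sum (map g xs) + sum (map g ys)
  sum-map-++ g xs ys = trans (cong sum (map-++ g xs ys)) (sum-++ (map g xs) (map g ys))

  sum-map-mono : ∀ {g h : A → ℕ} xs → (∀ x → g x ≤ h x) → sum (map g xs) ≤ sum (map h xs)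
  sum-map-mono [] g≤h = z≤n
  sum-map-mono (x ∷ xs) g≤h = +-mono-≤ (g≤h x) (sum-map-mono xs g≤h)

  sum-map-mono-< : ∀ {g h : A → ℕ} {w} xs → (∀ x → g x ≤ h x) → w ∈ xs → g w < h w →
                   sum (map g xs) < sum (map h xs)
  sum-map-mono-< (x ∷ xs) g≤h (here refl) gw<hw = +-mono-<-≤ gw<hw (sum-map-mono xs g≤h)
  sum-map-mono-< (x ∷ xs) g≤h (there w∈xs) gw<hw = +-mono-≤-< (g≤h x) (sum-map-mono-< xs g≤h w∈xs gw<hw)

  sum-map-bound : ∀ {c} (g : A → ℕ) xs → (∀ {x} → x ∈ xs → g x ≤ c) → sum (map g xs) ≤ length xs * c
  sum-map-bound g [] g≤c = z≤n
  sum-map-bound g (x ∷ xs) g≤c = +-mono-≤ (g≤c (here refl)) (sum-map-bound g xs (g≤c ∘ there))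

  AllPairs-mapWith : ∀ {P : A → Set} {R R′ : A → A → Set} → (∀ {a b} → P a → P b → R a b → R′ a b) →
                     ∀ {xs} → All P xs → AllPairs R xs → AllPairs R′ xs
  AllPairs-mapWith f [] [] = []
  AllPairs-mapWith f (pa ∷ ps) (ra ∷ rs) = All.zipWith (λ (pb , r) → f pa pb r) (ps , ra) ∷ AllPairs-mapWith f ps rs

  ∈⇒↭∷ : ∀ {z : A} {xs} → z ∈ xs → ∃[ ys ] xs ↭ z ∷ ys
  ∈⇒↭∷ {z} z∈xs with ys₁ , ys₂ , refl ← ∈-∃++ z∈xs = ys₁ ++ ys₂ , shift z ys₁ ys₂

  ∈-tail : ∀ {u v : A} {xs ys} → xs ↭ u ∷ ys → v ∈ xs → v ≢ u → v ∈ ys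
  ∈-tail xs↭ v∈xs v≢u with ∈-resp-↭ xs↭ v∈xs
  ... | here v≡u = contradiction v≡u v≢u
  ... | there v∈ys = v∈ys

  exchange-free : ∀ {y z : A} xs {ys zs} → zs ↭ z ∷ ys → z ∷ xs ++ y ∷ ys ↭ y ∷ xs ++ zs
  exchange-free {y} {z} xs {ys} {zs} zs↭ = begin
    z ∷ xs ++ y ∷ ys  ↭⟨ prep z (shift y xs ys) ⟩
    z ∷ y ∷ xs ++ ys  ↭⟨ swap z y ↭-refl ⟩
    y ∷ z ∷ xs ++ ys  ↭⟨ prep y (shift z xs ys) ⟨
    y ∷ xs ++ z ∷ ys  ↭⟨ prep y (++⁺ˡ xs zs↭) ⟨
    y ∷ xs ++ zs      ∎
    where open PermutationReasoning

  exchange-pair : ∀ {y z w : A} {xs ys} zs → xs ↭ z ∷ w ∷ ys → z ∷ ys ++ y ∷ w ∷ zs ↭ y ∷ xs ++ zs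
  exchange-pair {y} {z} {w} {xs} {ys} zs xs↭ = begin
    z ∷ ys ++ y ∷ w ∷ zs  ↭⟨ prep z (shifts ys (y ∷ w ∷ [])) ⟩
    z ∷ y ∷ w ∷ ys ++ zs  ↭⟨ swap z y ↭-refl ⟩
    y ∷ z ∷ w ∷ ys ++ zs  ↭⟨ prep y (++⁺ʳ zs xs↭) ⟨
    y ∷ xs ++ zs          ∎
    where open PermutationReasoning

  Unique-head : ∀ {x : A} {xs} → Unique (x ∷ xs) → x ∉ xs
  Unique-head = All¬⇒¬Any ∘ AllPairs.head

  Unique-resp-↭ : ∀ {xs ys : List A} → xs ↭ ys → Unique xs → Unique ys
  Unique-resp-↭ xs↭ys = Setoid.Unique-resp-↭ (↭⇒↭ₛ xs↭ys)
    where import Data.List.Relation.Binary.Permutation.Setoid.Properties (setoid A) as Setoid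

-- Families of perfect matchings on a list of vertices

-- Matchings are functions V → V of which only the restriction to the vertex list S matters;
-- the members of a family must therefore differ somewhere on S.
module MatchingFamilies {V : Set} (_≟_ : DecidableEquality V) where

  IsMatchingOn : List V → (V → V) → Set
  IsMatchingOn S f = ∀ {u} → u ∈ S → f u ∈ S × f (f u) ≡ u × f u ≢ u

  DifferOn : List V → (V → V) → (V → V) → Set
  DifferOn S f g = ∃[ u ] u ∈ S × f u ≢ g u

  record IsFamilyOn (S : List V) (L : List (V → V)) : Set where
    constructor family
    field
      isMatching : All (IsMatchingOn S) L
      distinct   : AllPairs (DifferOn S) L

  open IsFamilyOn

  involution-injective : ∀ {f : V → V} {u v} → f (f u) ≡ u → f (f v) ≡ v → f u ≡ f v → u ≡ v
  involution-injective {f} ffu≡u ffv≡v fu≡fv = trans (sym ffu≡u) (trans (cong f fu≡fv) ffv≡v)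

  partner∈tail : ∀ {x R f} → IsMatchingOn (x ∷ R) f → f x ∈ R
  partner∈tail m with m (here refl)
  ... | here fx≡x , _ , fx≢x = contradiction fx≡x fx≢x
  ... | there fx∈R , _ = fx∈R

  fibre : V → V → List (V → V) → List (V → V)
  fibre x z = filter (λ f → f x ≟ z)

  fibre-all : ∀ {Q : (V → V) → Set} x z {L} → All Q L → All (λ f → Q f × f x ≡ z) (fibre x z L)
  fibre-all x z {L} qs = All.zip (All-filter⁺ (λ f → f x ≟ z) qs , all-filter (λ f → f x ≟ z) L)

  length≤∑fibres : ∀ x Z L → All (λ f → f x ∈ Z) L → length L ≤ sum (map (λ z → length (fibre x z L)) Z)
  length≤∑fibres x Z [] _ = z≤n
  length≤∑fibres x Z (f ∷ L) (fx∈Z ∷ fxs∈Z) =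
    ≤-trans (s≤s (length≤∑fibres x Z L fxs∈Z)) (sum-map-mono-< Z grows fx∈Z grows-at-fx)
    where
    grows : ∀ z → length (fibre x z L) ≤ length (fibre x z (f ∷ L))
    grows z with f x ≟ z
    ... | yes _ = n≤1+n _
    ... | no _ = ≤-refl
    grows-at-fx : length (fibre x (f x) L) < length (fibre x (f x) (f ∷ L))
    grows-at-fx with f x ≟ f x
    ... | yes _ = ≤-refl
    ... | no fx≢fx = contradiction refl fx≢fx

  module Restriction {x z : V} {S S′ : List V} (S↭ : x ∷ z ∷ S′ ↭ S) (uS : Unique S) where

    private
      u : Unique (x ∷ z ∷ S′)
      u = Unique-resp-↭ (↭-sym S↭) uS

      into : ∀ {v} → v ∈ x ∷ z ∷ S′ → v ∈ S
      into = ∈-resp-↭ S↭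

      outOf : ∀ {v} → v ∈ S → v ∈ x ∷ z ∷ S′
      outOf = ∈-resp-↭ (↭-sym S↭)

    x∉S′ : x ∉ S′
    x∉S′ = Unique-head u ∘ there

    z∉S′ : z ∉ S′
    z∉S′ = Unique-head (AllPairs.tail u)

    unique : Unique S′
    unique = AllPairs.tail (AllPairs.tail u)

    restrict-isMatching : ∀ {f} → IsMatchingOn S f × f x ≡ z → IsMatchingOn S′ f
    restrict-isMatching {f} (m , fx≡z) {v} v∈S′ with m (into (there (there v∈S′)))
    ... | fv∈S , ffv≡v , fv≢v with outOf fv∈S
    ... | here fv≡x = contradiction (subst (_∈ S′) v≡z v∈S′) z∉S′
      where
      v≡z : v ≡ z
      v≡z = trans (sym ffv≡v) (trans (cong f fv≡x) fx≡z)
    ... | there (here fv≡z) = contradiction (subst (_∈ S′) v≡x v∈S′) x∉S′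
      where
      v≡x : v ≡ x
      v≡x = involution-injective ffv≡v (proj₁ (proj₂ (m (into (here refl))))) (trans fv≡z (sym fx≡z))
    ... | there (there fv∈S′) = fv∈S′ , ffv≡v , fv≢v

    restrict-differ : ∀ {f g} → IsMatchingOn S f × f x ≡ z → IsMatchingOn S g × g x ≡ z →
                      DifferOn S f g → DifferOn S′ f g
    restrict-differ {f} {g} (mf , fx≡z) (mg , gx≡z) (v , v∈S , fv≢gv) with outOf v∈S
    ... | here refl = contradiction (trans fx≡z (sym gx≡z)) fv≢gv
    ... | there (here refl) = contradiction (trans (partner mf fx≡z) (sym (partner mg gx≡z))) fv≢gv
      where
      partner : ∀ {h} → IsMatchingOn S h → h x ≡ z → h z ≡ x
      partner {h} mh hx≡z = trans (cong h (sym hx≡z)) (proj₁ (proj₂ (mh (into (here refl)))))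
    ... | there (there v∈S′) = v , v∈S′ , fv≢gv

    fibre-isFamily : ∀ {L} → IsFamilyOn S L → IsFamilyOn S′ (fibre x z L)
    fibre-isFamily fam = family
      (All.map restrict-isMatching restricted)
      (AllPairs-mapWith restrict-differ restricted (AllPairs-filter⁺ (λ f → f x ≟ z) (distinct fam)))
      where restricted = fibre-all x z (isMatching fam)

    fibre-transfer : ∀ {Q Q′ : (V → V) → Set} → (∀ {f} → IsMatchingOn S f → f x ≡ z → Q f → Q′ f) →
                     ∀ {L} → IsFamilyOn S L → All Q L → All Q′ (fibre x z L)
    fibre-transfer Q⇒Q′ fam qs =
      All.map (λ ((m , q) , fx≡z) → Q⇒Q′ m fx≡z q) (fibre-all x z (All.zip (isMatching fam , qs)))

  length≤matchings : ∀ ℓ S → length S ≡ ℓ → Unique S → ∀ {L} → IsFamilyOn S L → length L ≤ matchings ℓ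
  length≤matchings zero [] _ _ {[]} _ = z≤n
  length≤matchings zero [] _ _ {_ ∷ []} _ = ≤-refl
  length≤matchings zero [] _ _ {_ ∷ _ ∷ _} (family _ (((_ , () , _) ∷ _) ∷ _))
  length≤matchings (suc ℓ) (x ∷ R) len uS {L} fam = begin
    length L                       ≤⟨ length≤∑fibres x R L (All.map partner∈tail (isMatching fam)) ⟩
    sum (map g R)                  ≤⟨ sum-map-bound g R (fibre-bound ℓ (suc-injective len)) ⟩
    length R * matchings (pred ℓ)  ≡⟨ cong (_* matchings (pred ℓ)) (suc-injective len) ⟩
    ℓ * matchings (pred ℓ)         ≡⟨ matchings-suc ℓ ⟨
    matchings (suc ℓ)              ∎
    where
    open ≤-Reasoning
    g : V → ℕ
    g z = length (fibre x z L)
    fibre-bound : ∀ ℓ → length R ≡ ℓ → ∀ {z} → z ∈ R → g z ≤ matchings (pred ℓ)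
    fibre-bound ℓ lenR {z} z∈R with R′ , R↭ ← ∈⇒↭∷ z∈R with ℓ
    ... | zero = contradiction (trans (sym (↭-length R↭)) lenR) λ ()
    ... | suc ℓ′ = length≤matchings ℓ′ R′ (suc-injective (trans (sym (↭-length R↭)) lenR))
                     (Restriction.unique S↭ uS) (Restriction.fibre-isFamily S↭ uS fam)
      where
      S↭ : x ∷ z ∷ R′ ↭ x ∷ R
      S↭ = prep x (↭-sym R↭)

  points : List (V × V) → List V
  points [] = []
  points ((a , b) ∷ P) = a ∷ b ∷ points P

  length-points : ∀ P → length (points P) ≡ length P + length P
  length-points [] = refl
  length-points ((a , b) ∷ P) = cong suc (trans (cong suc (length-points P)) (sym (+-suc (length P) (length P))))

  Joins : (V → V) → V × V → Set
  Joins f e = f (proj₁ e) ≡ proj₂ e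

  Hits : List (V × V) → (V → V) → Set
  Hits P f = Any (Joins f) P

  record PairRemoval (P : List (V × V)) (z : V) : Set where
    field
      partner   : V
      rest      : List (V × V)
      points↭   : points P ↭ z ∷ partner ∷ points rest
      length≡   : length P ≡ suc (length rest)
      splitHits : ∀ {f} → (∀ {u} → u ∈ points P → f (f u) ≡ u) → Hits P f → f z ≡ partner ⊎ Hits rest f

  remove-pair : ∀ {z} P → z ∈ points P → PairRemoval P z
  remove-pair ((a , b) ∷ P) (here refl) = record
    { partner = b ; rest = P ; points↭ = ↭-refl ; length≡ = refl ; splitHits = split }
    where
    split : ∀ {f} → _ → Hits ((a , b) ∷ P) f → f a ≡ b ⊎ Hits P f
    split _ (here fa≡b) = inj₁ fa≡b
    split _ (there h) = inj₂ h
  remove-pair ((a , b) ∷ P) (there (here refl)) = record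
    { partner = a ; rest = P ; points↭ = swap a b ↭-refl ; length≡ = refl ; splitHits = split }
    where
    split : ∀ {f} → (∀ {u} → u ∈ points ((a , b) ∷ P) → f (f u) ≡ u) → Hits ((a , b) ∷ P) f →
            f b ≡ a ⊎ Hits P f
    split {f} inv (here fa≡b) = inj₁ (trans (cong f (sym fa≡b)) (inv (here refl)))
    split _ (there h) = inj₂ h
  remove-pair {z} ((a , b) ∷ P) (there (there z∈P)) = record
    { partner = partner
    ; rest = (a , b) ∷ rest
    ; points↭ = ↭-trans (prep a (prep b points↭)) (shifts (a ∷ b ∷ []) (z ∷ partner ∷ []))
    ; length≡ = cong suc length≡
    ; splitHits = split
    }
    where
    open PairRemoval (remove-pair P z∈P)
    split : ∀ {f} → (∀ {u} → u ∈ points ((a , b) ∷ P) → f (f u) ≡ u) → Hits ((a , b) ∷ P) f →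
            f z ≡ partner ⊎ Hits ((a , b) ∷ rest) f
    split _ (here fa≡b) = inj₂ (here fa≡b)
    split inv (there h) with splitHits (inv ∘ there ∘ there) h
    ... | inj₁ fz≡partner = inj₁ fz≡partner
    ... | inj₂ h′ = inj₂ (there h′)

  HittingBound : ℕ → ℕ → Set
  HittingBound r s = ∀ P F → length P ≡ r → length F ≡ s → Unique (points P ++ F) →
                     ∀ {L} → IsFamilyOn (points P ++ F) L → All (Hits P) L → length L ≤ hitting r s

  -- Sort the family by the partner of the first point x of the first pair (x , y): partner y
  -- leaves an arbitrary matching of the rest; a free partner turns y into a free point; the
  -- partner z of a pair (z , w) turns y and w into free points.
  module FirstPair {x y : V} {P₀ : List (V × V)} {F : List V} {r s : ℕ} (lenP₀ : length P₀ ≡ r) (lenF : length F ≡ s)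
                   (uS : Unique (x ∷ y ∷ points P₀ ++ F))
                   {L : List (V → V)} (fam : IsFamilyOn (x ∷ y ∷ points P₀ ++ F) L) (hits : All (Hits ((x , y) ∷ P₀)) L)
                   where

    private
      S : List V
      S = x ∷ y ∷ points P₀ ++ F

      g : V → ℕ
      g z = length (fibre x z L)

      lenPoints : length (points P₀) ≡ r + r
      lenPoints = trans (length-points P₀) (cong₂ _+_ lenP₀ lenP₀)

      involutive : ∀ {f} → IsMatchingOn S f → ∀ {u} → u ∈ points P₀ → f (f u) ≡ u
      involutive m u∈P₀ = proj₁ (proj₂ (m (there (there (∈-++⁺ˡ u∈P₀)))))

      dropFirst : ∀ {z f} → z ≢ y → f x ≡ z → Hits ((x , y) ∷ P₀) f → Hits P₀ f
      dropFirst z≢y fx≡z (here fx≡y) = contradiction (trans (sym fx≡z) fx≡y) z≢y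
      dropFirst _ _ (there h) = h

    fibre-at-partner : g y ≤ matchings (r + r + s)
    fibre-at-partner = length≤matchings (r + r + s) (points P₀ ++ F)
      (trans (length-++ (points P₀)) (cong₂ _+_ lenPoints lenF))
      (Restriction.unique ↭-refl uS) (Restriction.fibre-isFamily ↭-refl uS fam)

    fibre-at-free : HittingBound r s → ∀ {z} → z ∈ F → g z ≤ hitting r s
    fibre-at-free bound {z} z∈F with F′ , F↭ ← ∈⇒↭∷ z∈F =
      bound P₀ (y ∷ F′) lenP₀ (trans (sym (↭-length F↭)) lenF) R.unique (R.fibre-isFamily fam)
        (R.fibre-transfer (λ _ fx≡z → dropFirst z≢y fx≡z) fam hits)
      where
      S↭ : x ∷ z ∷ points P₀ ++ y ∷ F′ ↭ S
      S↭ = prep x (exchange-free (points P₀) F↭)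
      module R = Restriction S↭ uS
      z≢y : z ≢ y
      z≢y refl = R.z∉S′ (∈-++⁺ʳ (points P₀) (here refl))

    fibre-at-paired : HittingBound (pred r) (2 + s) → ∀ {z} → z ∈ points P₀ → g z ≤ hitting (pred r) (2 + s)
    fibre-at-paired bound {z} z∈P₀ =
      bound rest (y ∷ partner ∷ F) (cong pred (trans (sym length≡) lenP₀)) (cong (2 +_) lenF)
        R.unique (R.fibre-isFamily fam) (R.fibre-transfer transferHits fam hits)
      where
      open PairRemoval (remove-pair P₀ z∈P₀)
      S′ : List V
      S′ = points rest ++ y ∷ partner ∷ F
      S↭ : x ∷ z ∷ S′ ↭ S
      S↭ = prep x (exchange-pair F points↭)
      module R = Restriction S↭ uS
      z≢y : z ≢ y
      z≢y refl = R.z∉S′ (∈-++⁺ʳ (points rest) (here refl))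
      transferHits : ∀ {f} → IsMatchingOn S f → f x ≡ z → Hits ((x , y) ∷ P₀) f → Hits rest f
      transferHits {f} m fx≡z h with splitHits (involutive m) (dropFirst z≢y fx≡z h)
      ... | inj₂ h′ = h′
      ... | inj₁ fz≡partner =
        contradiction (subst (_∈ S′) partner≡x (∈-++⁺ʳ (points rest) (there (here refl)))) R.x∉S′
        where
        partner≡x : partner ≡ x
        partner≡x = trans (sym fz≡partner) (trans (cong f (sym fx≡z)) (proj₁ (proj₂ (m (here refl)))))

    length≤hitting-suc : HittingBound r s → HittingBound (pred r) (2 + s) → length L ≤ hitting (suc r) s
    length≤hitting-suc boundFree boundPaired = begin
      length L
        ≤⟨ length≤∑fibres x (y ∷ points P₀ ++ F) L (All.map partner∈tail (isMatching fam)) ⟩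
      g y + sum (map g (points P₀ ++ F))
        ≡⟨ cong (g y +_) (sum-map-++ g (points P₀) F) ⟩
      g y + (sum (map g (points P₀)) + sum (map g F))
        ≤⟨ +-mono-≤ fibre-at-partner (+-mono-≤ (sum-map-bound g (points P₀) (fibre-at-paired boundPaired))
                                               (sum-map-bound g F (fibre-at-free boundFree))) ⟩
      matchings (r + r + s) + (length (points P₀) * hitting (pred r) (2 + s) + length F * hitting r s)
        ≡⟨ cong₂ (λ a b → matchings (r + r + s) + (a * hitting (pred r) (2 + s) + b * hitting r s)) lenPoints lenF ⟩
      matchings (r + r + s) + ((r + r) * hitting (pred r) (2 + s) + s * hitting r s)
        ≡⟨ hitting-suc r s ⟨
      hitting (suc r) s ∎
      where open ≤-Reasoning

  length≤hitting : ∀ r s → HittingBound r s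
  length≤hitting zero s [] F _ _ _ {[]} _ _ = z≤n
  length≤hitting zero s [] F _ _ _ {_ ∷ _} _ (() ∷ _)
  length≤hitting (suc zero) s ((x , y) ∷ P₀) F lenP lenF uS fam hits =
    FirstPair.length≤hitting-suc (suc-injective lenP) lenF uS fam hits (length≤hitting 0 s) (length≤hitting 0 (2 + s))
  length≤hitting (suc (suc r)) s ((x , y) ∷ P₀) F lenP lenF uS fam hits =
    FirstPair.length≤hitting-suc (suc-injective lenP) lenF uS fam hits (length≤hitting (suc r) s) (length≤hitting r (2 + s))

  IsFreeInvolution : (V → V) → Set
  IsFreeInvolution h = ∀ v → h (h v) ≡ v × h v ≢ v

  closed-without-orbit : ∀ {h u R₀ R₁} → IsFreeInvolution h → R₀ ↭ h u ∷ R₁ → Unique (u ∷ R₀) →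
                         (∀ {v} → v ∈ u ∷ R₀ → h v ∈ u ∷ R₀) → ∀ {v} → v ∈ R₁ → h v ∈ R₁
  closed-without-orbit {h} {u} {R₀} {R₁} free R₀↭ uR closed {v} v∈R₁ =
    remaining (∈-resp-↭ R↭ (closed (∈-resp-↭ (↭-sym R↭) (there (there v∈R₁)))))
    where
    R↭ : u ∷ R₀ ↭ u ∷ h u ∷ R₁
    R↭ = prep u R₀↭
    u′ : Unique (u ∷ h u ∷ R₁)
    u′ = Unique-resp-↭ R↭ uR
    remaining : h v ∈ u ∷ h u ∷ R₁ → h v ∈ R₁
    remaining (here hv≡u) = contradiction (subst (_∈ R₁) v≡hu v∈R₁) (Unique-head (AllPairs.tail u′))
      where
      v≡hu : v ≡ h u
      v≡hu = trans (sym (proj₁ (free v))) (cong h hv≡u)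
    remaining (there (here hv≡hu)) = contradiction (subst (_∈ R₁) v≡u v∈R₁) (Unique-head u′ ∘ there)
      where
      v≡u : v ≡ u
      v≡u = involution-injective (proj₁ (free v)) (proj₁ (free u)) hv≡hu
    remaining (there (there hv∈R₁)) = hv∈R₁

  pairing : ∀ {h} → IsFreeInvolution h → ∀ ℓ R → length R ≡ ℓ → Unique R → (∀ {v} → v ∈ R → h v ∈ R) →
            ∃[ P ] points P ↭ R × All (Joins h) P
  pairing free zero [] _ _ _ = [] , ↭-refl , []
  pairing free (suc zero) (u ∷ []) _ _ closed with closed (here refl)
  ... | here hu≡u = contradiction hu≡u (proj₂ (free u))
  pairing {h} free (suc (suc ℓ)) (u ∷ R₀) len uR closed
    with R₁ , R₀↭ ← ∈⇒↭∷ (∈-tail ↭-refl (closed (here refl)) (proj₂ (free u)))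
    with P , P↭ , joins ← pairing free ℓ R₁ (suc-injective (suc-injective (trans (sym (↭-length (prep u R₀↭))) len)))
                                  (AllPairs.tail (AllPairs.tail (Unique-resp-↭ (prep u R₀↭) uR)))
                                  (closed-without-orbit free R₀↭ uR closed)
    = (u , h u) ∷ P , ↭-trans (prep u (prep (h u) P↭)) (↭-sym (prep u R₀↭)) , refl ∷ joins

  hits-at-shared-edge : ∀ {h f} → IsFreeInvolution h → IsFreeInvolution f →
                        ∀ P → All (Joins h) P → ∀ {v} → v ∈ points P → f v ≡ h v → Hits P f
  hits-at-shared-edge _ _ ((a , b) ∷ P) (ha≡b ∷ _) (here refl) fa≡ha = here (trans fa≡ha ha≡b)
  hits-at-shared-edge {h} {f} h-free f-free ((a , b) ∷ P) (ha≡b ∷ _) (there (here refl)) fb≡hb =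
    here (trans (cong f (sym fb≡a)) (proj₁ (f-free b)))
    where
    fb≡a : f b ≡ a
    fb≡a = trans fb≡hb (trans (cong h (sym ha≡b)) (proj₁ (h-free a)))
  hits-at-shared-edge h-free f-free (_ ∷ P) (_ ∷ joins) (there (there v∈P)) fv≡hv =
    there (hits-at-shared-edge h-free f-free P joins v∈P fv≡hv)

  -- Once a matching contains the edge ij, the vertices a = m′ i and b = m′ j are free, and m′
  -- pairs up the remaining vertices R.
  module SharedEdge {U : List V} (complete : ∀ v → v ∈ U) (uU : Unique U)
                    {m′ : V → V} (m′-free : IsFreeInvolution m′) {i j : V} (i≢j : i ≢ j) (m′i≢j : m′ i ≢ j) where

    IsCandidate : (V → V) → Set
    IsCandidate f = IsFreeInvolution f × f i ≡ j × ∃[ v ] f v ≡ m′ v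

    private
      a b : V
      a = m′ i
      b = m′ j

      m′-inv : ∀ v → m′ (m′ v) ≡ v
      m′-inv v = proj₁ (m′-free v)

      b≢i : b ≢ i
      b≢i m′j≡i = m′i≢j (trans (cong m′ (sym m′j≡i)) (m′-inv j))

      b≢a : b ≢ a
      b≢a m′j≡m′i = i≢j (sym (involution-injective (m′-inv j) (m′-inv i) m′j≡m′i))

      remove-four : ∃[ R ] U ↭ i ∷ j ∷ a ∷ b ∷ R
      remove-four
        with U₁ , U↭₁ ← ∈⇒↭∷ (complete i)
        with U₂ , U↭₂ ← ∈⇒↭∷ (∈-tail U↭₁ (complete j) (i≢j ∘ sym))
        with U₃ , U↭₃ ← ∈⇒↭∷ (∈-tail U↭₂ (∈-tail U↭₁ (complete a) (proj₂ (m′-free i))) m′i≢j)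
        with R , U↭₄ ← ∈⇒↭∷ (∈-tail U↭₃ (∈-tail U↭₂ (∈-tail U↭₁ (complete b) b≢i) (proj₂ (m′-free j)))
                                     b≢a)
        = R , ↭-trans U↭₁ (prep i (↭-trans U↭₂ (prep j (↭-trans U↭₃ (prep a U↭₄)))))

      module Rest (R : List V) (U↭ : U ↭ i ∷ j ∷ a ∷ b ∷ R) where

        uIJABR : Unique (i ∷ j ∷ a ∷ b ∷ R)
        uIJABR = Unique-resp-↭ U↭ uU

        uR : Unique R
        uR = AllPairs.tail (AllPairs.tail (AllPairs.tail (AllPairs.tail uIJABR)))

        i∉R : i ∉ R
        i∉R = Unique-head uIJABR ∘ there ∘ there ∘ there

        j∉R : j ∉ R
        j∉R = Unique-head (AllPairs.tail uIJABR) ∘ there ∘ there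

        a∉R : a ∉ R
        a∉R = Unique-head (AllPairs.tail (AllPairs.tail uIJABR)) ∘ there

        b∉R : b ∉ R
        b∉R = Unique-head (AllPairs.tail (AllPairs.tail (AllPairs.tail uIJABR)))

        closed : ∀ {v} → v ∈ R → m′ v ∈ R
        closed {v} v∈R with ∈-resp-↭ U↭ (complete (m′ v))
        ... | here m′v≡i = contradiction (subst (_∈ R) (trans (sym (m′-inv v)) (cong m′ m′v≡i)) v∈R) a∉R
        ... | there (here m′v≡j) = contradiction (subst (_∈ R) (trans (sym (m′-inv v)) (cong m′ m′v≡j)) v∈R) b∉R
        ... | there (there (here m′v≡a)) =
                contradiction (subst (_∈ R) (involution-injective (m′-inv v) (m′-inv i) m′v≡a) v∈R) i∉R
        ... | there (there (there (here m′v≡b))) =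
                contradiction (subst (_∈ R) (involution-injective (m′-inv v) (m′-inv j) m′v≡b) v∈R) j∉R
        ... | there (there (there (there m′v∈R))) = m′v∈R

        module Pairs (P : List (V × V)) (P↭R : points P ↭ R) (joins : All (Joins m′) P) where

          S : List V
          S = points P ++ a ∷ b ∷ []

          S↭ : i ∷ j ∷ S ↭ U
          S↭ = ↭-trans (prep i (prep j (↭-trans (↭-++-comm (points P) (a ∷ b ∷ [])) (prep a (prep b P↭R)))))
                       (↭-sym U↭)

          lengthU : length U ≡ 4 + (length P + length P)
          lengthU = trans (↭-length U↭) (cong (4 +_) (trans (sym (↭-length P↭R)) (length-points P)))

          candidate-hits : ∀ {f} → IsCandidate f → Hits P f
          candidate-hits {f} (f-free , fi≡j , v , fv≡m′v) = locate (∈-resp-↭ U↭ (complete v))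
            where
            f-inv : ∀ u → f (f u) ≡ u
            f-inv u = proj₁ (f-free u)
            fj≡i : f j ≡ i
            fj≡i = trans (cong f (sym fi≡j)) (f-inv i)
            m′w≡fw : ∀ {w} → v ≡ w → m′ w ≡ f w
            m′w≡fw refl = sym fv≡m′v
            locate : v ∈ i ∷ j ∷ a ∷ b ∷ R → Hits P f
            locate (here v≡i) = contradiction (trans (m′w≡fw v≡i) fi≡j) m′i≢j
            locate (there (here v≡j)) = contradiction (trans (m′w≡fw v≡j) fj≡i) b≢i
            locate (there (there (here v≡a))) =
              contradiction (trans (sym (f-inv a)) (trans (cong f (trans (sym (m′w≡fw v≡a)) (m′-inv i))) fi≡j)) m′i≢j
            locate (there (there (there (here v≡b)))) =
              contradiction (trans (sym (f-inv b)) (trans (cong f (trans (sym (m′w≡fw v≡b)) (m′-inv j))) fj≡i)) b≢i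
            locate (there (there (there (there v∈R)))) =
              hits-at-shared-edge m′-free f-free P joins (∈-resp-↭ (↭-sym P↭R) v∈R) fv≡m′v

          bound : ∀ {L} → All IsCandidate L → AllPairs (DifferOn U) L → length L ≤ hitting (length P) 2
          bound {L} candidates distinct =
            length≤hitting (length P) 2 P (a ∷ b ∷ []) refl refl (Restriction.unique S↭ uU) familyOnS
              (All.map candidate-hits candidates)
            where
            familyOnU : IsFamilyOn U L
            familyOnU = family (All.map (λ (free , _) {u} _ → complete _ , free u) candidates) distinct
            familyOnS : IsFamilyOn S L
            familyOnS = subst (IsFamilyOn S) (filter-all (λ f → f i ≟ j) (All.map (proj₁ ∘ proj₂) candidates))
                              (Restriction.fibre-isFamily S↭ uU familyOnU)

    candidates≤hitting : ∀ {L} → All IsCandidate L → AllPairs (DifferOn U) L →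
                         ∃[ p ] length U ≡ 4 + (p + p) × length L ≤ hitting p 2
    candidates≤hitting candidates distinct
      with R , U↭ ← remove-four
      with P , P↭R , joins ← pairing m′-free (length R) R refl (Rest.uR R U↭) (Rest.closed R U↭)
      = length P , Pairs.lengthU P P↭R joins , Pairs.bound P P↭R joins candidates distinct
      where open Rest R U↭

dfact≡matchings : ∀ m → dfact (suc m) ≡ matchings (m + m)
dfact≡matchings zero = refl
dfact≡matchings (suc m) = begin
  (2 * m + 1) * dfact (suc m)      ≡⟨ cong₂ _*_ (2m+1≡1+m+m m) (dfact≡matchings m) ⟩
  suc (m + m) * matchings (m + m)  ≡⟨ cong (λ k → matchings (suc k)) (+-suc m m) ⟨
  matchings (suc m + suc m)        ∎
  where
  open ≡-Reasoning
  2m+1≡1+m+m : ∀ m → 2 * m + 1 ≡ suc (m + m)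
  2m+1≡1+m+m = solve-∀

dfact>0 : ∀ n → 0 < dfact n
dfact>0 zero = z<s
dfact>0 (suc zero) = z<s
dfact>0 (suc (suc n)) = *-mono-< (subst (0 <_) (+-comm 1 (2 * n)) z<s) (dfact>0 (suc n))

dfact[2+p]≡matchings : ∀ p → dfact (2 + p) ≡ matchings (2 + (p + p))
dfact[2+p]≡matchings p = trans (dfact≡matchings (suc p)) (cong (λ k → matchings (suc k)) (+-suc p p))

hitting-LeOneMinusInvSqrtE : ∀ p {c} → c ≤ hitting p 2 → LeOneMinusInvSqrtE c (matchings (2 + (p + p)))
hitting-LeOneMinusInvSqrtE p {c} c≤hitting =
  LeOneMinusInvSqrtE-fromRatio b c+A≤D (subst (0 <_) (dfact[2+p]≡matchings p) (dfact>0 (2 + p))) ratio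
  where
  b = p + p
  D = matchings (2 + b)
  A = avoiding p 2
  c+A≤D : c + A ≤ D
  c+A≤D = ≤-trans (+-monoˡ-≤ A c≤hitting)
                  (≤-reflexive (trans (hitting+avoiding≡matchings p 2) (cong matchings (+-comm b 2))))
  lower : b ^ p * D ≤ suc b ^ p * A
  lower = subst (λ q → q ^ p * matchings (2 + q) ≤ suc q ^ p * A) (+-identityʳ b) (avoiding-lowerBound p 0)
  interchange : ∀ x y → (x * x) * (y * y) ≡ (x * y) * (x * y)
  interchange = solve-∀
  ratio : b ^ b * (D * D) ≤ suc b ^ b * (A * A)
  ratio = begin
    b ^ (p + p) * (D * D)              ≡⟨ cong (_* (D * D)) (^-distribˡ-+-* b p p) ⟩
    (b ^ p * b ^ p) * (D * D)          ≡⟨ interchange (b ^ p) D ⟩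
    (b ^ p * D) * (b ^ p * D)          ≤⟨ *-mono-≤ lower lower ⟩
    (suc b ^ p * A) * (suc b ^ p * A)  ≡⟨ interchange (suc b ^ p) A ⟨
    (suc b ^ p * suc b ^ p) * (A * A)  ≡⟨ cong (_* (A * A)) (^-distribˡ-+-* (suc b) p p) ⟨
    suc b ^ (p + p) * (A * A)          ∎
    where open ≤-Reasoning

sharedEdgeMatchings≤hitting : (n : ℕ) (i j : Fin (2 * n)) → i ≢ j →
  (m' : Vec (Fin (2 * n)) (2 * n)) → IsPerfectMatching m' → lookup m' i ≢ j →
  (L : List (Vec (Fin (2 * n)) (2 * n))) → Unique L →
  All (λ m → IsPerfectMatching m × (lookup m i ≡ j) × ∃ (λ x → lookup m x ≡ lookup m' x)) L →
  ∃[ p ] n ≡ 2 + p × length L ≤ hitting p 2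
sharedEdgeMatchings≤hitting n i j i≢j m' pm m'i≢j L uL allL =
  conclude (candidates≤hitting (All-map⁺ allL) distinct)
  where
  open MatchingFamilies (_≟ᶠ_ {2 * n})
  open SharedEdge ∈-allFin (allFin⁺ (2 * n)) pm i≢j m'i≢j
  lookup-differ : ∀ {m₁ m₂ : Vec (Fin (2 * n)) (2 * n)} → m₁ ≢ m₂ →
                  DifferOn (allFin (2 * n)) (lookup m₁) (lookup m₂)
  lookup-differ {m₁} {m₂} m₁≢m₂ =
    map₂ (λ {u} m₁u≢m₂u → ∈-allFin u , m₁u≢m₂u)
         (¬∀⟶∃¬ (2 * n) _ (λ u → lookup m₁ u ≟ᶠ lookup m₂ u) pointwise≢)
    where
    pointwise≢ : ¬ (∀ u → lookup m₁ u ≡ lookup m₂ u)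
    pointwise≢ eq = m₁≢m₂ (trans (sym (tabulate∘lookup m₁)) (trans (tabulate-cong eq) (tabulate∘lookup m₂)))
  distinct : AllPairs (DifferOn (allFin (2 * n))) (map lookup L)
  distinct = AllPairs-map⁺ (AllPairs.map {S = λ m₁ m₂ → DifferOn (allFin (2 * n)) (lookup m₁) (lookup m₂)}
                                         lookup-differ uL)
  conclude : ∃[ p ] length (allFin (2 * n)) ≡ 4 + (p + p) × length (map lookup L) ≤ hitting p 2 →
             ∃[ p ] n ≡ 2 + p × length L ≤ hitting p 2
  conclude (p , lengthU , bound) =
    p , *-cancelˡ-≡ n (2 + p) 2 (trans (sym (length-tabulate (λ u → u))) (trans lengthU (double p))) ,
    subst (_≤ hitting p 2) (length-map lookup L) bound
    where
    double : ∀ p → 4 + (p + p) ≡ 2 * (2 + p)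
    double = solve-∀

proposition8p2 : (n : ℕ) (i j : Fin (2 * n)) → i ≢ j →
    (m' : Vec (Fin (2 * n)) (2 * n)) → IsPerfectMatching m' → lookup m' i ≢ j →
    (L : List (Vec (Fin (2 * n)) (2 * n))) → Unique L →
    All (λ m → IsPerfectMatching m × (lookup m i ≡ j) × ∃ (λ x → lookup m x ≡ lookup m' x)) L →
    LeOneMinusInvSqrtE (length L) (dfact n) × (5 * length L < 2 * dfact n)
proposition8p2 n i j i≢j m' pm m'i≢j L uL allL =
  conclude (sharedEdgeMatchings≤hitting n i j i≢j m' pm m'i≢j L uL allL)
  where
  conclude : ∃[ p ] n ≡ 2 + p × length L ≤ hitting p 2 →
             LeOneMinusInvSqrtE (length L) (dfact n) × (5 * length L < 2 * dfact n)
  conclude (p , n≡2+p , L≤hitting) = bound , LeOneMinusInvSqrtE⇒5c<2D bound (dfact>0 n)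
    where
    bound : LeOneMinusInvSqrtE (length L) (dfact n)
    bound = subst (LeOneMinusInvSqrtE (length L)) (sym (trans (cong dfact n≡2+p) (dfact[2+p]≡matchings p)))
                  (hitting-LeOneMinusInvSqrtE p L≤hitting)
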